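{- Consider the preorder on propositional containers in which $A\triangleleft P\le B\triangleleft Q$ holds iff there exists a morphism $A\triangleleft P\to B\triangleleft Q$ in $\mathbf{PCont}$, i.e. iff $\exists f:A\to B.\,\forall a:A.\,Q(f\,a)\Rightarrow P\,a$ (the preorder of functional instance reducibilities). This preorder is a Heyting prealgebra, i.e. it has finite meets, finite joins and Heyting implications.
   Context: Work in extensional type theory with a universe $\mathbf{Prop}$ of propositions supporting intuitionistic logic, proof irrelevance and propositional extensionality. A propositional container $A\triangleleft P$ is a type $A$ with $P:A\to\mathbf{Prop}$; $\mathbf{PCont}$ is the category of propositional containers whose morphisms $A\triangleleft P\to B\triangleleft Q$ are maps $f:A\to B$ with $\forall a:A.\,Q(f\,a)\Rightarrow P\,a$. -}

module Defs where

open import Level using (Level; suc; _⊔_) renaming (zero to lzero)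
open import Data.Product using (Σ; _×_; _,_; proj₁; proj₂)
open import Data.Sum using (_⊎_)
open import Data.Empty using (⊥)
open import Data.Unit using (⊤)
open import Relation.Binary.PropositionalEquality using (_≡_)
open import Relation.Binary.Core using (Rel)
open import Relation.Binary.Lattice.Structures using (IsHeytingAlgebra)

-- The ambient universe  Prop  of the paper: an (impredicative) universe
-- of propositions  Ω : Set  (i.e. living in the same universe as the
-- types it quantifies over), with decoding  El, supporting intuitionistic
-- logic (⊤, ⊥, ∧, ∨, ⇒, ∀, ∃ over arbitrary types), proof irrelevance and
-- propositional extensionality.  Agda has no impredicative Prop, so this
-- universe is taken as a parameter.

record PropUniverse : Set₁ where
  field
    Ω  : Set
    El : Ω → Set
    irrelevant : ∀ {p} (x y : El p) → x ≡ y
    propext : ∀ {p q} → (El p → El q) → (El q → El p) → p ≡ q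
    ⊤Ω    : Ω
    ⊤Ω-intro : El ⊤Ω
    ⊥Ω    : Ω
    ⊥Ω-elim : ∀ {r} → El ⊥Ω → El r
    _∧Ω_  : Ω → Ω → Ω
    ∧Ω-intro : ∀ {p q} → El p → El q → El (p ∧Ω q)
    ∧Ω-fst : ∀ {p q} → El (p ∧Ω q) → El p
    ∧Ω-snd : ∀ {p q} → El (p ∧Ω q) → El q
    _∨Ω_  : Ω → Ω → Ω
    ∨Ω-inl : ∀ {p q} → El p → El (p ∨Ω q)
    ∨Ω-inr : ∀ {p q} → El q → El (p ∨Ω q)
    ∨Ω-elim : ∀ {p q r} → (El p → El r) → (El q → El r) → El (p ∨Ω q) → El r
    _⇒Ω_  : Ω → Ω → Ω
    ⇒Ω-intro : ∀ {p q} → (El p → El q) → El (p ⇒Ω q)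
    ⇒Ω-elim : ∀ {p q} → El (p ⇒Ω q) → El p → El q
    ∀Ω : (A : Set) → (A → Ω) → Ω
    ∀Ω-intro : ∀ {A φ} → ((a : A) → El (φ a)) → El (∀Ω A φ)
    ∀Ω-elim : ∀ {A φ} → El (∀Ω A φ) → (a : A) → El (φ a)
    ∃Ω : (A : Set) → (A → Ω) → Ω
    ∃Ω-intro : ∀ {A φ} (a : A) → El (φ a) → El (∃Ω A φ)
    ∃Ω-elim : ∀ {A φ r} → ((a : A) → El (φ a) → El r) → El (∃Ω A φ) → El r

module Containers (𝒫 : PropUniverse) where
  open PropUniverse 𝒫

  record PCont : Set₁ where
    constructor _◁_
    field
      Shape : Set
      Pos   : Shape → Ω
  open PCont public

  Hom : PCont → PCont → Set
  Hom (A ◁ P) (B ◁ Q) = Σ (A → B) λ f → (a : A) → El (Q (f a)) → El (P a)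

  _≤_ : Rel PCont lzero
  X ≤ Y = Hom X Y

  _≃_ : Rel PCont lzero
  X ≃ Y = (X ≤ Y) × (Y ≤ X)

  IsHeytingPrealgebra : Set₁
  IsHeytingPrealgebra =
    Σ (PCont → PCont → PCont) λ _∨_ →
    Σ (PCont → PCont → PCont) λ _∧_ →
    Σ (PCont → PCont → PCont) λ _⇨_ →
    Σ PCont λ top →
    Σ PCont λ bot →
    IsHeytingAlgebra _≃_ _≤_ _∨_ _∧_ _⇨_ top bot

-- Coproducts of containers are joins and products (with positions combined by
-- ∨, since reductions pull positions back) are meets.  A reduction W ∧ X ≤ Y
-- sends each shape c of W to a reduction of X to Y that only establishes
-- R c ∨ P a instead of P a; so the shapes of X ⇨ Y are pairs of a proposition s
-- and such an s-weakened reduction, with position s.  This is a small type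
-- because Prop is impredicative.
module Submission where

open import Defs
open import Data.Product using (Σ; _×_; _,_; proj₁; proj₂)
open import Data.Sum using (_⊎_; inj₁; inj₂; [_,_])
open import Data.Empty using (⊥)
open import Data.Unit using (⊤; tt)
open import Function using (id; _∘_)
open import Relation.Binary.Structures using (IsPartialOrder)
open import Relation.Binary.Definitions using (Maximum; Minimum)
open import Relation.Binary.Lattice.Definitions using (Supremum; Infimum; Exponential)

module HeytingPrealgebra (𝒫 : PropUniverse) where
  open PropUniverse 𝒫
  open Containers 𝒫

  ≤-refl : ∀ {X} → X ≤ X
  ≤-refl = id , λ _ → id

  ≤-trans : ∀ {X Y Z} → X ≤ Y → Y ≤ Z → X ≤ Z
  ≤-trans (f , f-pos) (g , g-pos) = g ∘ f , λ a → f-pos a ∘ g-pos (f a)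

  ≤-isPartialOrder : IsPartialOrder _≃_ _≤_
  ≤-isPartialOrder = record
    { isPreorder = record
      { isEquivalence = record
        { refl  = ≤-refl , ≤-refl
        ; sym   = λ (X≤Y , Y≤X) → Y≤X , X≤Y
        ; trans = λ {X} {Y} {Z} (X≤Y , Y≤X) (Y≤Z , Z≤Y) →
                    ≤-trans {X} {Y} {Z} X≤Y Y≤Z , ≤-trans {Z} {Y} {X} Z≤Y Y≤X
        }
      ; reflexive = proj₁
      ; trans     = λ {X} {Y} {Z} → ≤-trans {X} {Y} {Z}
      }
    ; antisym = _,_
    }

  infixr 30 _∧_
  infixr 25 _∨_
  infixr 22 _⇨_

  _∨_ : PCont → PCont → PCont
  (A ◁ P) ∨ (B ◁ Q) = (A ⊎ B) ◁ [ P , Q ]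

  _∧_ : PCont → PCont → PCont
  (A ◁ P) ∧ (B ◁ Q) = (A × B) ◁ λ (a , b) → P a ∨Ω Q b

  weaken : Ω → PCont → PCont
  weaken s (A ◁ P) = A ◁ λ a → s ∨Ω P a

  _⇨_ : PCont → PCont → PCont
  X ⇨ Y = (Σ Ω λ s → weaken s X ≤ Y) ◁ proj₁

  top : PCont
  top = ⊤ ◁ λ _ → ⊥Ω

  bot : PCont
  bot = ⊥ ◁ λ ()

  ∨-supremum : Supremum _≤_ _∨_
  ∨-supremum X Y =
    (inj₁ , λ _ → id) , (inj₂ , λ _ → id) ,
    λ Z (f , f-pos) (g , g-pos) → [ f , g ] , [ f-pos , g-pos ]

  ∧-infimum : Infimum _≤_ _∧_
  ∧-infimum X Y =
    (proj₁ , λ _ → ∨Ω-inl) , (proj₂ , λ _ → ∨Ω-inr) ,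
    λ Z (f , f-pos) (g , g-pos) → (λ c → f c , g c) , λ c → ∨Ω-elim (f-pos c) (g-pos c)

  top-maximum : Maximum _≤_ top
  top-maximum X = (λ _ → tt) , λ _ → ⊥Ω-elim

  bot-minimum : Minimum _≤_ bot
  bot-minimum X = (λ ()) , λ ()

  ⇨-exponential : Exponential _≤_ _∧_ _⇨_
  ⇨-exponential (C ◁ R) X Y = curry , uncurry
    where
    curry : (C ◁ R) ∧ X ≤ Y → (C ◁ R) ≤ X ⇨ Y
    curry (f , f-pos) = (λ c → R c , (λ a → f (c , a)) , λ a → f-pos (c , a)) , λ _ → id

    uncurry : (C ◁ R) ≤ X ⇨ Y → (C ◁ R) ∧ X ≤ Y
    uncurry (g , g-pos) =
      (λ (c , a) → proj₁ (proj₂ (g c)) a) ,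
      λ (c , a) → ∨Ω-elim (∨Ω-inl ∘ g-pos c) ∨Ω-inr ∘ proj₂ (proj₂ (g c)) a

  isHeytingPrealgebra : IsHeytingPrealgebra
  isHeytingPrealgebra = _∨_ , _∧_ , _⇨_ , top , bot , record
    { isBoundedLattice = record
      { isLattice = record
        { isPartialOrder = ≤-isPartialOrder
        ; supremum       = ∨-supremum
        ; infimum        = ∧-infimum
        }
      ; maximum = top-maximum
      ; minimum = bot-minimum
      }
    ; exponential = ⇨-exponential
    }

corollary13 : (𝒫 : PropUniverse) → Containers.IsHeytingPrealgebra 𝒫
corollary13 = HeytingPrealgebra.isHeytingPrealgebra
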